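{- Let $h:\mathbb{Z}_{\ge0}\to\mathbb{Z}_{\ge0}$ be nondecreasing and satisfy: for all $z,z'\in\mathbb{Z}_{\ge0}$ and every positive integer $i$, if $\lfloor z/2^i\rfloor=\lfloor z'/2^i\rfloor$ then $\lfloor h(z)/2^{i-1}\rfloor=\lfloor h(z')/2^{i-1}\rfloor$. Let $x,y,z\in\mathbb{Z}_{\ge0}$ with $x\oplus y\oplus z\neq0$ and $y\le h(z)$. Then at least one of the following holds: (1) $u\oplus y\oplus z=0$ for some $u\in\mathbb{Z}_{\ge0}$ with $u<x$; (2) $x\oplus v\oplus z=0$ for some $v\in\mathbb{Z}_{\ge0}$ with $v<y$; (3) $x\oplus y\oplus w=0$ for some $w\in\mathbb{Z}_{\ge0}$ with $w<z$ and $y\le h(w)$; (4) $x\oplus v\oplus w'=0$ for some $v,w'\in\mathbb{Z}_{\ge0}$ with $v<y$, $w'<z$ and $v=h(w')$.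
   Context: $\oplus$ denotes nim-sum (bitwise XOR of binary expansions). -}

module Defs where

open import Data.Nat using (ℕ; zero; suc; _+_; _*_; _^_; _/_; _%_)
open import Data.Bool using (Bool; true; false; _xor_)

bit0 : ℕ → Bool
bit0 n = n % 2 Data.Nat.≡ᵇ 1

fromBit : Bool → ℕ
fromBit true  = 1
fromBit false = 0

-- Bitwise XOR with an explicit fuel argument; fuel ≥ number of binary
-- digits of the inputs suffices (a + b is always enough).
xorFuel : ℕ → ℕ → ℕ → ℕ
xorFuel zero    a b = 0
xorFuel (suc k) a b =
  fromBit (bit0 a xor bit0 b) + 2 * xorFuel k (a / 2) (b / 2)

infixl 6 _⊕_
_⊕_ : ℕ → ℕ → ℕ
a ⊕ b = xorFuel (a + b) a b

shiftR : ℕ → ℕ → ℕ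
shiftR n zero    = n
shiftR n (suc i) = shiftR (n / 2) i

-- Let s = x ⊕ y ⊕ z ≠ 0 and let k be its highest binary digit. One of x, y, z has digit 1 at k, and
-- taking its nim-sum with s lowers it and makes the total nim-sum 0. This gives (1), (2), or, for z,
-- the position w = z ⊕ s, which satisfies (3) unless h w < y. In that case let j be the highest digit
-- where h w and y differ. The contraction condition makes h w agree with h z above digit k, so
-- h w < y ≤ h z forces y to agree with them there too, whence j < k. The map w′ ↦ w′ ⊕ h w′ sends the
-- block of numbers sharing the digits of w from j + 1 up onto the block of x (fix one digit at a time;
-- by contraction this does not disturb the higher digits of h), so some w′ in that block has
-- w′ ⊕ h w′ = x. Then v = h w′ agrees with h w from digit j up, hence v < y; w′ < z since j < k; and
-- x ⊕ v ⊕ w′ = 0.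

module Submission where

open import Defs
open import Data.Nat using (ℕ; suc; _≤_; _<_)
open import Data.Product using (∃; _×_; _,_)
open import Data.Sum using (_⊎_)
open import Relation.Binary.PropositionalEquality using (_≡_; _≢_)

open import Algebra.Bundles using (CommutativeMonoid)
open import Algebra.Structures using (IsCommutativeMonoid)
open import Data.Bool using (Bool; true; false; _xor_)
open import Data.Bool.Properties using (xor-assoc; xor-comm; xor-same; xor-identityʳ)
open import Data.Nat using (zero; _+_; _*_; _/_; _%_; _≡ᵇ_; _≟_; _≤?_; z≤n; s≤s; s≤s⁻¹; _≤′_; ≤′-refl; ≤′-step)
open import Data.Nat.DivMod
open import Data.Nat.Properties
open import Data.Sum using (inj₁; inj₂)
open import Function using (_∘_)
open import Relation.Binary.PropositionalEquality using (refl; sym; trans; cong; cong₂; subst; subst₂; isEquivalence; module ≡-Reasoning)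
open import Relation.Nullary using (yes; no)

private
  variable
    a b c j k m n q s w x y z : ℕ

-- Binary digits

infixr 5 _∷ᵇ_
_∷ᵇ_ : Bool → ℕ → ℕ
d ∷ᵇ q = fromBit d + q * 2

bit : ℕ → ℕ → Bool
bit n i = bit0 (shiftR n i)

fromBit-bit0 : ∀ n → fromBit (bit0 n) ≡ n % 2
fromBit-bit0 n with n % 2 | m%n<n n 2
... | 0 | _ = refl
... | 1 | _ = refl
... | suc (suc _) | s≤s (s≤s ())

∷ᵇ-η : ∀ n → n ≡ bit0 n ∷ᵇ (n / 2)
∷ᵇ-η n = trans (m≡m%n+[m/n]*n n 2) (cong (_+ n / 2 * 2) (sym (fromBit-bit0 n)))

bit0-∷ᵇ : ∀ d q → bit0 (d ∷ᵇ q) ≡ d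
bit0-∷ᵇ false q = cong (_≡ᵇ 1) (m*n%n≡0 q 2)
bit0-∷ᵇ true  q = cong (_≡ᵇ 1) ([m+kn]%n≡m%n 1 q 2)

/2-∷ᵇ : ∀ d q → (d ∷ᵇ q) / 2 ≡ q
/2-∷ᵇ false q = m*n/n≡m q 2
/2-∷ᵇ true  q = trans (+-distrib-/ 1 (q * 2) 1+0<2) (m*n/n≡m q 2)
  where
  1+0<2 : 1 % 2 + q * 2 % 2 < 2
  1+0<2 = subst (λ r → 1 + r < 2) (sym (m*n%n≡0 q 2)) ≤-refl

∷ᵇ-injective : bit0 a ≡ bit0 b → a / 2 ≡ b / 2 → a ≡ b
∷ᵇ-injective {a} {b} eq₀ eq = trans (∷ᵇ-η a) (trans (cong₂ _∷ᵇ_ eq₀ eq) (sym (∷ᵇ-η b)))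

∷ᵇ-<⁻¹ : ∀ {d e} → d ∷ᵇ q < e ∷ᵇ q → d ≡ false × e ≡ true
∷ᵇ-<⁻¹ {q} {d} {e} lt = fromBit-<⁻¹ (+-cancelʳ-< (q * 2) (fromBit d) (fromBit e) lt)
  where
  fromBit-<⁻¹ : ∀ {d e} → fromBit d < fromBit e → d ≡ false × e ≡ true
  fromBit-<⁻¹ {false} {true}  _ = refl , refl
  fromBit-<⁻¹ {false} {false} ()
  fromBit-<⁻¹ {true}  {true}  (s≤s ())

/2-≤ : a ≤ suc k → a / 2 ≤ k
/2-≤ {a} {k} a≤ = ≤-trans (/-monoˡ-≤ 2 a≤) (s≤s⁻¹ (m/n<m (suc k) 2 ≤-refl))

/2-+-≤ : ∀ a b → a + b ≤ suc k → a / 2 + b / 2 ≤ k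
/2-+-≤ {k} a b a+b≤ = begin
  a / 2 + b / 2             ≡⟨ m*n/n≡m (a / 2 + b / 2) 2 ⟨
  (a / 2 + b / 2) * 2 / 2   ≤⟨ /-monoˡ-≤ 2 halves≤ ⟩
  (a + b) / 2               ≤⟨ /2-≤ a+b≤ ⟩
  k                         ∎
  where
  open ≤-Reasoning
  halves≤ : (a / 2 + b / 2) * 2 ≤ a + b
  halves≤ = ≤-trans (≤-reflexive (*-distribʳ-+ 2 (a / 2) (b / 2))) (+-mono-≤ (m/n*n≤m a 2) (m/n*n≤m b 2))

-- Nim-sum, digit by digit

xorFuel-0-0 : ∀ k → xorFuel k 0 0 ≡ 0
xorFuel-0-0 zero    = refl
xorFuel-0-0 (suc k) = cong (λ r → 2 * r) (xorFuel-0-0 k)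

xorFuel-irrelevant : ∀ a b {k k′} → a + b ≤ k → a + b ≤ k′ → xorFuel k a b ≡ xorFuel k′ a b
xorFuel-irrelevant 0       0       {k}     {k′}     _ _ = trans (xorFuel-0-0 k) (sym (xorFuel-0-0 k′))
xorFuel-irrelevant 0       (suc b) {zero}  {_}      () _
xorFuel-irrelevant 0       (suc b) {suc k} {zero}   _ ()
xorFuel-irrelevant (suc a) b       {zero}  {_}      () _
xorFuel-irrelevant (suc a) b       {suc k} {zero}   _ ()
xorFuel-irrelevant a       b       {suc k} {suc k′} p p′ =
  cong (λ r → fromBit (bit0 a xor bit0 b) + 2 * r) (xorFuel-irrelevant (a / 2) (b / 2) (/2-+-≤ a b p) (/2-+-≤ a b p′))

⊕-∷ᵇ : ∀ a b → a ⊕ b ≡ (bit0 a xor bit0 b) ∷ᵇ (a / 2 ⊕ b / 2)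
⊕-∷ᵇ a b = begin
  xorFuel (a + b) a b
    ≡⟨ xorFuel-irrelevant a b ≤-refl (n≤1+n (a + b)) ⟩
  fromBit d + 2 * xorFuel (a + b) (a / 2) (b / 2)
    ≡⟨ cong (fromBit d +_) (*-comm 2 (xorFuel (a + b) (a / 2) (b / 2))) ⟩
  d ∷ᵇ xorFuel (a + b) (a / 2) (b / 2)
    ≡⟨ cong (d ∷ᵇ_) (xorFuel-irrelevant (a / 2) (b / 2) (/2-+-≤ a b (n≤1+n (a + b))) ≤-refl) ⟩
  d ∷ᵇ (a / 2 ⊕ b / 2)
    ∎
  where
  open ≡-Reasoning
  d : Bool
  d = bit0 a xor bit0 b

bit0-⊕ : ∀ a b → bit0 (a ⊕ b) ≡ bit0 a xor bit0 b
bit0-⊕ a b = trans (cong bit0 (⊕-∷ᵇ a b)) (bit0-∷ᵇ (bit0 a xor bit0 b) (a / 2 ⊕ b / 2))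

/2-⊕ : ∀ a b → (a ⊕ b) / 2 ≡ a / 2 ⊕ b / 2
/2-⊕ a b = trans (cong (_/ 2) (⊕-∷ᵇ a b)) (/2-∷ᵇ (bit0 a xor bit0 b) (a / 2 ⊕ b / 2))

shiftR-⊕ : ∀ i a b → shiftR (a ⊕ b) i ≡ shiftR a i ⊕ shiftR b i
shiftR-⊕ zero    a b = refl
shiftR-⊕ (suc i) a b = trans (cong (λ r → shiftR r i) (/2-⊕ a b)) (shiftR-⊕ i (a / 2) (b / 2))

bit-⊕ : ∀ i a b → bit (a ⊕ b) i ≡ bit a i xor bit b i
bit-⊕ i a b = trans (cong bit0 (shiftR-⊕ i a b)) (bit0-⊕ (shiftR a i) (shiftR b i))

shiftR-0 : ∀ i → shiftR 0 i ≡ 0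
shiftR-0 zero    = refl
shiftR-0 (suc i) = shiftR-0 i

bit-extensionality : (∀ i → bit a i ≡ bit b i) → a ≡ b
bit-extensionality {a} {b} = go a b ≤-refl
  where
  go : ∀ a b {k} → a + b ≤ k → (∀ i → bit a i ≡ bit b i) → a ≡ b
  go 0       0       _  _ = refl
  go 0       (suc b) {zero}  () _
  go (suc a) b       {zero}  () _
  go a       b       {suc k} p  eq = ∷ᵇ-injective (eq 0) (go (a / 2) (b / 2) (/2-+-≤ a b p) (eq ∘ suc))

bit-0 : ∀ i → bit 0 i ≡ false
bit-0 i = cong bit0 (shiftR-0 i)

⊕-comm : ∀ a b → a ⊕ b ≡ b ⊕ a
⊕-comm a b = bit-extensionality λ i →
  trans (bit-⊕ i a b) (trans (xor-comm (bit a i) (bit b i)) (sym (bit-⊕ i b a)))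

⊕-assoc : ∀ a b c → a ⊕ b ⊕ c ≡ a ⊕ (b ⊕ c)
⊕-assoc a b c = bit-extensionality λ i → begin
  bit (a ⊕ b ⊕ c) i                   ≡⟨ trans (bit-⊕ i (a ⊕ b) c) (cong (_xor bit c i) (bit-⊕ i a b)) ⟩
  (bit a i xor bit b i) xor bit c i   ≡⟨ xor-assoc (bit a i) (bit b i) (bit c i) ⟩
  bit a i xor (bit b i xor bit c i)   ≡⟨ sym (trans (bit-⊕ i a (b ⊕ c)) (cong (bit a i xor_) (bit-⊕ i b c))) ⟩
  bit (a ⊕ (b ⊕ c)) i                 ∎
  where open ≡-Reasoning

⊕-identityʳ : ∀ a → a ⊕ 0 ≡ a
⊕-identityʳ a = bit-extensionality λ i →
  trans (bit-⊕ i a 0) (trans (cong (bit a i xor_) (bit-0 i)) (xor-identityʳ (bit a i)))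

⊕-identityˡ : ∀ a → 0 ⊕ a ≡ a
⊕-identityˡ a = trans (⊕-comm 0 a) (⊕-identityʳ a)

⊕-same : ∀ a → a ⊕ a ≡ 0
⊕-same a = bit-extensionality λ i →
  trans (bit-⊕ i a a) (trans (xor-same (bit a i)) (sym (bit-0 i)))

⊕-cancelʳ : ∀ a b → a ⊕ b ⊕ b ≡ a
⊕-cancelʳ a b = trans (⊕-assoc a b b) (trans (cong (a ⊕_) (⊕-same b)) (⊕-identityʳ a))

⊕≡0⇒≡ : ∀ a b → a ⊕ b ≡ 0 → a ≡ b
⊕≡0⇒≡ a b eq = trans (sym (⊕-cancelʳ a b)) (trans (cong (_⊕ b) eq) (⊕-identityˡ b))

⊕≡0-rotate : ∀ a b c → a ⊕ b ⊕ c ≡ 0 → c ⊕ b ≡ a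
⊕≡0-rotate a b c eq = trans (cong (_⊕ b) (sym (⊕≡0⇒≡ (a ⊕ b) c eq))) (⊕-cancelʳ a b)

⊕-isCommutativeMonoid : IsCommutativeMonoid _≡_ _⊕_ 0
⊕-isCommutativeMonoid = record
  { isMonoid = record
    { isSemigroup = record
      { isMagma = record { isEquivalence = isEquivalence ; ∙-cong = cong₂ _⊕_ }
      ; assoc   = ⊕-assoc
      }
    ; identity = ⊕-identityˡ , ⊕-identityʳ
    }
  ; comm = ⊕-comm
  }

⊕-commutativeMonoid : CommutativeMonoid _ _
⊕-commutativeMonoid = record { isCommutativeMonoid = ⊕-isCommutativeMonoid }

-- Comparing numbers by their high digits

shiftR-suc : ∀ i a → shiftR a (suc i) ≡ shiftR a i / 2
shiftR-suc zero    a = refl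
shiftR-suc (suc i) a = shiftR-suc i (a / 2)

shiftR-mono-≤ : ∀ i → a ≤ b → shiftR a i ≤ shiftR b i
shiftR-mono-≤ zero    a≤b = a≤b
shiftR-mono-≤ (suc i) a≤b = shiftR-mono-≤ i (/-monoˡ-≤ 2 a≤b)

shiftR-<⇒< : ∀ i → shiftR a i < shiftR b i → a < b
shiftR-<⇒< i lt = ≰⇒> (<⇒≱ lt ∘ shiftR-mono-≤ i)

shiftR-≡-suc : ∀ i → shiftR a i ≡ shiftR b i → shiftR a (suc i) ≡ shiftR b (suc i)
shiftR-≡-suc {a} {b} i eq = trans (shiftR-suc i a) (trans (cong (_/ 2) eq) (sym (shiftR-suc i b)))

shiftR-≡-mono : m ≤ n → shiftR a m ≡ shiftR b m → shiftR a n ≡ shiftR b n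
shiftR-≡-mono m≤n = go (≤⇒≤′ m≤n)
  where
  go : m ≤′ n → shiftR a m ≡ shiftR b m → shiftR a n ≡ shiftR b n
  go ≤′-refl                 eq = eq
  go (≤′-step {n = n} m≤′n) eq = shiftR-≡-suc n (go m≤′n eq)

shiftR-≡-unsuc : ∀ i → bit a i ≡ bit b i → shiftR a (suc i) ≡ shiftR b (suc i) → shiftR a i ≡ shiftR b i
shiftR-≡-unsuc {a} {b} i bit≡ eq = ∷ᵇ-injective bit≡ (trans (sym (shiftR-suc i a)) (trans eq (shiftR-suc i b)))

shiftR-squeeze : ∀ i → a ≤ b → b ≤ c → shiftR a i ≡ shiftR c i → shiftR a i ≡ shiftR b i
shiftR-squeeze i a≤b b≤c eq =
  ≤-antisym (shiftR-mono-≤ i a≤b) (≤-trans (shiftR-mono-≤ i b≤c) (≤-reflexive (sym eq)))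

record LessAtBit (j a b : ℕ) : Set where
  constructor lessAtBit
  field
    above : shiftR a (suc j) ≡ shiftR b (suc j)
    bitˡ  : bit a j ≡ false
    bitʳ  : bit b j ≡ true

LessAtBit⇒shiftR-< : LessAtBit j a b → shiftR a j < shiftR b j
LessAtBit⇒shiftR-< {j} {a} {b} (lessAtBit above a[j] b[j]) = begin-strict
  shiftR a j                    ≡⟨ ∷ᵇ-η (shiftR a j) ⟩
  bit a j ∷ᵇ shiftR a j / 2     ≡⟨ cong₂ _∷ᵇ_ a[j] (sym (shiftR-suc j a)) ⟩
  false ∷ᵇ shiftR a (suc j)     <⟨ ≤-refl ⟩
  true ∷ᵇ shiftR a (suc j)      ≡⟨ cong₂ _∷ᵇ_ (sym b[j]) (trans above (shiftR-suc j b)) ⟩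
  bit b j ∷ᵇ shiftR b j / 2     ≡⟨ ∷ᵇ-η (shiftR b j) ⟨
  shiftR b j                    ∎
  where open ≤-Reasoning

LessAtBit⇒< : LessAtBit j a b → a < b
LessAtBit⇒< {j} = shiftR-<⇒< j ∘ LessAtBit⇒shiftR-<

LessAtBit-0 : a < b → a / 2 ≡ b / 2 → LessAtBit 0 a b
LessAtBit-0 {a} {b} a<b halves≡
  with ∷ᵇ-<⁻¹ {q = a / 2} (subst₂ _<_ (∷ᵇ-η a) (trans (∷ᵇ-η b) (cong (bit0 b ∷ᵇ_) (sym halves≡))) a<b)
... | a[0] , b[0] = lessAtBit halves≡ a[0] b[0]

<⇒LessAtBit : a < b → ∃ λ j → LessAtBit j a b
<⇒LessAtBit {a} {b} = go a b ≤-refl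
  where
  go : ∀ a b {k} → b ≤ k → a < b → ∃ λ j → LessAtBit j a b
  go a b    {suc k} b≤ a<b with a / 2 ≟ b / 2
  ... | yes halves≡ = 0 , LessAtBit-0 a<b halves≡
  ... | no  halves≢ with go (a / 2) (b / 2) (/2-≤ b≤) (≤∧≢⇒< (/-monoˡ-≤ 2 (<⇒≤ a<b)) halves≢)
  ...   | j , lessAtBit above a[j] b[j] = suc j , lessAtBit above a[j] b[j]
  go a zero {zero}  z≤n ()

LessAtBit-below : shiftR a m ≡ shiftR b m → LessAtBit j a b → j < m
LessAtBit-below eq (lessAtBit _ a[j] b[j]) =
  ≰⇒> λ m≤j → false≢true (trans (sym a[j]) (trans (cong bit0 (shiftR-≡-mono m≤j eq)) b[j]))
  where
  false≢true : false ≢ true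
  false≢true ()

LessAtBit-⊕ : LessAtBit k 0 s → bit a k ≡ true → LessAtBit k (a ⊕ s) a
LessAtBit-⊕ {k} {s} {a} (lessAtBit 0≈s _ s[k]) a[k] =
  lessAtBit above (trans (bit-⊕ k a s) (cong₂ _xor_ a[k] s[k])) a[k]
  where
  open ≡-Reasoning
  above : shiftR (a ⊕ s) (suc k) ≡ shiftR a (suc k)
  above = begin
    shiftR (a ⊕ s) (suc k)                ≡⟨ shiftR-⊕ (suc k) a s ⟩
    shiftR a (suc k) ⊕ shiftR s (suc k)   ≡⟨ cong (shiftR a (suc k) ⊕_) (trans (sym 0≈s) (shiftR-0 (suc k))) ⟩
    shiftR a (suc k) ⊕ 0                  ≡⟨ ⊕-identityʳ (shiftR a (suc k)) ⟩
    shiftR a (suc k)                      ∎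

bit-⊕₃ : ∀ i a b c → bit (a ⊕ b ⊕ c) i ≡ (bit a i xor bit b i) xor bit c i
bit-⊕₃ i a b c = trans (bit-⊕ i (a ⊕ b) c) (cong (_xor bit c i) (bit-⊕ i a b))

xor-≡true⇒ : ∀ d e f → (d xor e) xor f ≡ true → d ≡ true ⊎ e ≡ true ⊎ f ≡ true
xor-≡true⇒ true  _    _ _  = inj₁ refl
xor-≡true⇒ false true _ _  = inj₂ (inj₁ refl)
xor-≡true⇒ false false _ f = inj₂ (inj₂ f)

-- The contraction condition

shiftR-surjective : ∀ i n → ∃ λ a → shiftR a i ≡ n
shiftR-surjective zero    n = n , refl
shiftR-surjective (suc i) n with shiftR-surjective i n
... | a , eq = a * 2 , trans (cong (λ r → shiftR r i) (m*n/n≡m a 2)) eq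

xor-cancelʳ : ∀ d e → (d xor e) xor e ≡ d
xor-cancelʳ d e = trans (xor-assoc d e e) (trans (cong (d xor_) (xor-same e)) (xor-identityʳ d))

shiftR-⊕-congˡ : ∀ i a → shiftR b i ≡ shiftR c i → shiftR (a ⊕ b) i ≡ shiftR (a ⊕ c) i
shiftR-⊕-congˡ {b} {c} i a eq =
  trans (shiftR-⊕ i a b) (trans (cong (shiftR a i ⊕_) eq) (sym (shiftR-⊕ i a c)))

-- For the ultrametric d(a, b) = 2 ^ (highest digit where a and b differ): d(h z, h z′) ≤ d(z, z′) / 2.
Contracting : (ℕ → ℕ) → Set
Contracting h = ∀ z z′ i → shiftR z (suc i) ≡ shiftR z′ (suc i) → shiftR (h z) i ≡ shiftR (h z′) i

module _ {h : ℕ → ℕ} (contracting : Contracting h) where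

  ⊕-contraction-fixDigit : ∀ i w t → shiftR (w ⊕ h w) (suc i) ≡ shiftR t (suc i) →
    ∃ λ w₁ → shiftR w₁ (suc i) ≡ shiftR w (suc i) × shiftR (w₁ ⊕ h w₁) i ≡ shiftR t i
  ⊕-contraction-fixDigit i w t eq with shiftR-surjective i ((bit t i xor bit (h w) i) ∷ᵇ shiftR w (suc i))
  ... | w₁ , w₁-digits = w₁ , w₁≈w , shiftR-≡-unsuc i digit≡ above≡
    where
    open ≡-Reasoning
    d : Bool
    d = bit t i xor bit (h w) i
    w₁≈w : shiftR w₁ (suc i) ≡ shiftR w (suc i)
    w₁≈w = trans (shiftR-suc i w₁) (trans (cong (_/ 2) w₁-digits) (/2-∷ᵇ d (shiftR w (suc i))))
    hw₁≈hw : shiftR (h w₁) i ≡ shiftR (h w) i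
    hw₁≈hw = contracting w₁ w i w₁≈w
    digit≡ : bit (w₁ ⊕ h w₁) i ≡ bit t i
    digit≡ = begin
      bit (w₁ ⊕ h w₁) i           ≡⟨ bit-⊕ i w₁ (h w₁) ⟩
      bit w₁ i xor bit (h w₁) i   ≡⟨ cong₂ _xor_ (trans (cong bit0 w₁-digits) (bit0-∷ᵇ d (shiftR w (suc i)))) (cong bit0 hw₁≈hw) ⟩
      d xor bit (h w) i           ≡⟨ xor-cancelʳ (bit t i) (bit (h w) i) ⟩
      bit t i                     ∎
    above≡ : shiftR (w₁ ⊕ h w₁) (suc i) ≡ shiftR t (suc i)
    above≡ = begin
      shiftR (w₁ ⊕ h w₁) (suc i)                  ≡⟨ shiftR-⊕ (suc i) w₁ (h w₁) ⟩
      shiftR w₁ (suc i) ⊕ shiftR (h w₁) (suc i)   ≡⟨ cong₂ _⊕_ w₁≈w (shiftR-≡-suc i hw₁≈hw) ⟩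
      shiftR w (suc i) ⊕ shiftR (h w) (suc i)     ≡⟨ shiftR-⊕ (suc i) w (h w) ⟨
      shiftR (w ⊕ h w) (suc i)                    ≡⟨ eq ⟩
      shiftR t (suc i)                            ∎

  ⊕-contraction-surjective : ∀ i w t → shiftR (w ⊕ h w) i ≡ shiftR t i →
    ∃ λ w′ → shiftR w′ i ≡ shiftR w i × w′ ⊕ h w′ ≡ t
  ⊕-contraction-surjective zero    w t eq = w , refl , eq
  ⊕-contraction-surjective (suc i) w t eq with ⊕-contraction-fixDigit i w t eq
  ... | w₁ , w₁≈w , eq₁ with ⊕-contraction-surjective i w₁ t eq₁
  ...   | w′ , w′≈w₁ , w′⊕hw′≡t = w′ , trans (shiftR-≡-suc i w′≈w₁) w₁≈w , w′⊕hw′≡t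

  lowerBothBelow : j < k → LessAtBit k w z → LessAtBit j (h w) y → x ⊕ y ⊕ w ≡ 0 →
    ∃ λ v → ∃ λ w′ → v < y × w′ < z × v ≡ h w′ × x ⊕ v ⊕ w′ ≡ 0
  lowerBothBelow {j} {k} {w} {z} {y} {x} j<k w<z hw<y sum≡0
    with ⊕-contraction-surjective (suc j) w x
           (trans (shiftR-⊕-congˡ {h w} {y} (suc j) w (LessAtBit.above hw<y))
                  (cong (λ r → shiftR r (suc j)) (⊕≡0-rotate x y w sum≡0)))
  ... | w′ , w′≈w , w′⊕hw′≡x = h w′ , w′ , hw′<y , w′<z , refl , sum′≡0
    where
    hw′<y : h w′ < y
    hw′<y = shiftR-<⇒< j (begin-strict
      shiftR (h w′) j   ≡⟨ contracting w′ w j w′≈w ⟩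
      shiftR (h w) j    <⟨ LessAtBit⇒shiftR-< hw<y ⟩
      shiftR y j        ∎)
      where open ≤-Reasoning
    w′<z : w′ < z
    w′<z = shiftR-<⇒< k (begin-strict
      shiftR w′ k   ≡⟨ shiftR-≡-mono j<k w′≈w ⟩
      shiftR w k    <⟨ LessAtBit⇒shiftR-< w<z ⟩
      shiftR z k    ∎)
      where open ≤-Reasoning
    sum′≡0 : x ⊕ h w′ ⊕ w′ ≡ 0
    sum′≡0 = begin
      x ⊕ h w′ ⊕ w′               ≡⟨ cong (λ r → r ⊕ h w′ ⊕ w′) w′⊕hw′≡x ⟨
      w′ ⊕ h w′ ⊕ h w′ ⊕ w′       ≡⟨ cong (_⊕ w′) (⊕-cancelʳ w′ (h w′)) ⟩
      w′ ⊕ w′                     ≡⟨ ⊕-same w′ ⟩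
      0                           ∎
      where open ≡-Reasoning

  lowerBoth : LessAtBit k w z → x ⊕ y ⊕ w ≡ 0 → y ≤ h z → h w < y →
    ∃ λ v → ∃ λ w′ → v < y × w′ < z × v ≡ h w′ × x ⊕ v ⊕ w′ ≡ 0
  lowerBoth {k} {w} {z} {x} {y} w<z sum≡0 y≤hz hw<y with <⇒LessAtBit hw<y
  ... | j , hw<y[j] = lowerBothBelow {x = x} (LessAtBit-below hw≈y hw<y[j]) w<z hw<y[j] sum≡0
    where
    hw≈y : shiftR (h w) k ≡ shiftR y k
    hw≈y = shiftR-squeeze k (<⇒≤ hw<y) y≤hz (contracting w z k (LessAtBit.above w<z))

open import Algebra.Solver.CommutativeMonoid ⊕-commutativeMonoid using (solve; _⊜_) renaming (_⊕_ to _⊛_)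

⊕-flip₁ : ∀ a b c → (a ⊕ (a ⊕ b ⊕ c)) ⊕ b ⊕ c ≡ 0
⊕-flip₁ a b c =
  trans (solve 4 (λ a b c s → ((a ⊛ s) ⊛ b) ⊛ c ⊜ s ⊛ ((a ⊛ b) ⊛ c)) refl a b c (a ⊕ b ⊕ c))
        (⊕-same (a ⊕ b ⊕ c))

⊕-flip₂ : ∀ a b c → a ⊕ (b ⊕ (a ⊕ b ⊕ c)) ⊕ c ≡ 0
⊕-flip₂ a b c =
  trans (solve 4 (λ a b c s → (a ⊛ (b ⊛ s)) ⊛ c ⊜ s ⊛ ((a ⊛ b) ⊛ c)) refl a b c (a ⊕ b ⊕ c))
        (⊕-same (a ⊕ b ⊕ c))

⊕-flip₃ : ∀ a b c → a ⊕ b ⊕ (c ⊕ (a ⊕ b ⊕ c)) ≡ 0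
⊕-flip₃ a b c =
  trans (solve 4 (λ a b c s → (a ⊛ b) ⊛ (c ⊛ s) ⊜ s ⊛ ((a ⊛ b) ⊛ c)) refl a b c (a ⊕ b ⊕ c))
        (⊕-same (a ⊕ b ⊕ c))

mainTheorem10 : (h : ℕ → ℕ) →
    (∀ {a b} → a ≤ b → h a ≤ h b) →
    (∀ (z z' i : ℕ) → shiftR z (suc i) ≡ shiftR z' (suc i) → shiftR (h z) i ≡ shiftR (h z') i) →
    (x y z : ℕ) → x ⊕ y ⊕ z ≢ 0 → y ≤ h z →
    (∃ λ u → u < x × u ⊕ y ⊕ z ≡ 0)
    ⊎ (∃ λ v → v < y × x ⊕ v ⊕ z ≡ 0)
    ⊎ (∃ λ w → w < z × y ≤ h w × x ⊕ y ⊕ w ≡ 0)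
    ⊎ (∃ λ v → ∃ λ w' → v < y × w' < z × v ≡ h w' × x ⊕ v ⊕ w' ≡ 0)
mainTheorem10 h _ contracting x y z s≢0 y≤hz with <⇒LessAtBit (n≢0⇒n>0 s≢0)
... | k , top
  with xor-≡true⇒ (bit x k) (bit y k) (bit z k) (trans (sym (bit-⊕₃ k x y z)) (LessAtBit.bitʳ top))
... | inj₁ x[k] = inj₁ (x ⊕ (x ⊕ y ⊕ z) , LessAtBit⇒< (LessAtBit-⊕ top x[k]) , ⊕-flip₁ x y z)
... | inj₂ (inj₁ y[k]) = inj₂ (inj₁ (y ⊕ (x ⊕ y ⊕ z) , LessAtBit⇒< (LessAtBit-⊕ top y[k]) , ⊕-flip₂ x y z))
... | inj₂ (inj₂ z[k]) with y ≤? h (z ⊕ (x ⊕ y ⊕ z))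
...   | yes y≤hw = inj₂ (inj₂ (inj₁ (z ⊕ (x ⊕ y ⊕ z) , LessAtBit⇒< (LessAtBit-⊕ top z[k]) , y≤hw , ⊕-flip₃ x y z)))
...   | no  y≰hw =
  inj₂ (inj₂ (inj₂ (lowerBoth contracting {x = x} (LessAtBit-⊕ top z[k]) (⊕-flip₃ x y z) y≤hz (≰⇒> y≰hw))))
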